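{- Let $G\in\mathcal{G}_n$ and suppose $w,x,y$ form a triangle lying in a connected component of $G$ with at least 8 vertices. Then there exist a vertex $v$ and a graph $G'\in\mathcal{G}_n$ at distance at most two from $G$ in $\mathcal{G}_n^*$ such that $v,w,x,y$ induce a diamond in $G'$.
   Context: $\mathcal{G}_n$ is the set of simple 3-regular graphs on vertex set $[n]$, $n\ge4$ even. A make move ${\tt make}(yxvwz)$ applies to $G=(V,E)$ when $y,x,v,w,z$ are distinct, $yx,xv,vw,wz\in E$ and $xw,yz\notin E$, and replaces $E$ by $(E\setminus\{xy,wz\})\cup\{xw,yz\}$. A break move ${\tt break}(vxw,yz)$ applies when $vxwv$ is a triangle, $yz\in E$, $\{y,z\}\cap\{v,x,w\}=\emptyset$ and $xy,wz\notin E$, and replaces $E$ by $(E\setminus\{xw,yz\})\cup\{xy,wz\}$. $\mathcal{G}_n^*$ is the graph on vertex set $\mathcal{G}_n$ with $G,G'$ adjacent iff a make or break move takes $G$ to $G'$; distance is graph distance in $\mathcal{G}_n^*$. A diamond is the graph $K_4$ minus one edge. -}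

module Defs where

open import Data.Nat using (ℕ; zero; suc; _+_)
open import Data.Fin using (Fin)
open import Data.Bool using (Bool; true; false; if_then_else_)
open import Data.List using (List; map; allFin)
open import Data.Nat.ListAction using (sum)
open import Data.Product using (Σ; ∃; _×_; _,_)
open import Data.Sum using (_⊎_)
open import Relation.Nullary using (¬_)
open import Relation.Binary.PropositionalEquality using (_≡_; _≢_)
open import Function.Bundles using (_⇔_)
open import Function.Definitions using (Injective)

b2n : Bool → ℕ
b2n true  = 1
b2n false = 0

record Cubic (n : ℕ) : Set where
  field
    adj    : Fin n → Fin n → Bool
    sym    : ∀ a b → adj a b ≡ adj b a
    irrefl : ∀ a → adj a a ≡ false
    deg3   : ∀ a → sum (map (λ b → b2n (adj a b)) (allFin n)) ≡ 3
open Cubic public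

E : ∀ {n} → Cubic n → Fin n → Fin n → Set
E G a b = adj G a b ≡ true

SamePair : ∀ {n} → Fin n → Fin n → Fin n → Fin n → Set
SamePair a b c d = (a ≡ c × b ≡ d) ⊎ (a ≡ d × b ≡ c)

Replaces : ∀ {n} → Cubic n → Cubic n →
           (p q r s t u k l : Fin n) → Set
Replaces G G' p q r s t u k l =
  ∀ a b → E G' a b ⇔
    ((E G a b × ¬ SamePair a b p q × ¬ SamePair a b r s)
     ⊎ SamePair a b t u ⊎ SamePair a b k l)

Make : ∀ {n} → Cubic n → Cubic n → Set
Make {n} G G' = Σ (Fin n) λ y → Σ (Fin n) λ x → Σ (Fin n) λ v →
  Σ (Fin n) λ w → Σ (Fin n) λ z →
    (y ≢ x × y ≢ v × y ≢ w × y ≢ z × x ≢ v × x ≢ w × x ≢ z ×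
     v ≢ w × v ≢ z × w ≢ z)
  × E G y x × E G x v × E G v w × E G w z
  × ¬ E G x w × ¬ E G y z
  × Replaces G G' x y w z x w y z

Break : ∀ {n} → Cubic n → Cubic n → Set
Break {n} G G' = Σ (Fin n) λ v → Σ (Fin n) λ x → Σ (Fin n) λ w →
  Σ (Fin n) λ y → Σ (Fin n) λ z →
    (E G v x × E G x w × E G w v)
  × E G y z
  × (y ≢ v × y ≢ x × y ≢ w × z ≢ v × z ≢ x × z ≢ w)
  × ¬ E G x y × ¬ E G w z
  × Replaces G G' x w y z x y w z

Move : ∀ {n} → Cubic n → Cubic n → Set
Move G G' = Make G G' ⊎ Break G G'

Adjacent : ∀ {n} → Cubic n → Cubic n → Set
Adjacent G G' = Move G G' ⊎ Move G' G

SameGraph : ∀ {n} → Cubic n → Cubic n → Set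
SameGraph G G' = ∀ a b → adj G a b ≡ adj G' a b

DistLe2 : ∀ {n} → Cubic n → Cubic n → Set
DistLe2 G G' = SameGraph G G' ⊎ Adjacent G G' ⊎
  (∃ λ G₁ → Adjacent G G₁ × Adjacent G₁ G')

data Reach {n} (G : Cubic n) : Fin n → Fin n → Set where
  here : ∀ {a} → Reach G a a
  step : ∀ {a b c} → E G a b → Reach G b c → Reach G a c

ComponentAtLeast8 : ∀ {n} → Cubic n → Fin n → Set
ComponentAtLeast8 {n} G a =
  Σ (Fin 8 → Fin n) λ f → Injective _≡_ _≡_ f × (∀ i → Reach G a (f i))

Triangle : ∀ {n} → Cubic n → Fin n → Fin n → Fin n → Set
Triangle G a b c = E G a b × E G b c × E G c a

-- a, b, c, d are distinct and induce a diamond (K4 minus an edge):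
-- exactly five of the six pairs are edges.
InducedDiamond : ∀ {n} → Cubic n → Fin n → Fin n → Fin n → Fin n → Set
InducedDiamond G a b c d =
  (a ≢ b × a ≢ c × a ≢ d × b ≢ c × b ≢ d × c ≢ d) ×
  (b2n (adj G a b) + b2n (adj G a c) + b2n (adj G a d) +
   b2n (adj G b c) + b2n (adj G b d) + b2n (adj G c d) ≡ 5)

module Submission where

-- Let w', x', y' be the third neighbours of w, x, y.  If they all coincide,
-- w x y w' is a K4 component; if exactly two coincide, the shared vertex
-- already spans a diamond with the triangle.  Otherwise let p, q be the two
-- neighbours of w' besides w.  If some d ∈ {p, q} is neither equal nor
-- adjacent to x' (resp. y'), the single move make(d w' w x x') (resp. with
-- y, y') joins w' to x (resp. y).  If instead every d ∈ {p, q} is equal or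
-- adjacent to both x' and y', an equality would produce a prism component
-- or a vertex of degree four, so p, q ~ x', y' and the two moves
-- make(x' p w' q y'), make(q x' x y y') join x' to y.

open import Defs hiding (sym)
open import Data.Bool using (Bool; true; false; if_then_else_)
import Data.Bool.Properties as Bool
open import Data.Empty using (⊥; ⊥-elim)
open import Data.Fin using (Fin; zero; suc)
open import Data.Fin.Properties using (_≟_; injective⇒≤)
open import Data.List using (tabulate)
open import Data.List.Properties using (map-tabulate)
open import Data.Nat using (ℕ; zero; suc; _+_; _≤_; _<_; s≤s; z≤n)
open import Data.Nat.Divisibility using (_∣_)
open import Data.Nat.ListAction using (sum)
import Data.Nat.Properties as ℕ
open import Data.Product using (Σ; ∃; _×_; _,_; proj₁; proj₂)
open import Data.Sum using (_⊎_; inj₁; inj₂; [_,_]′)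
import Data.Sum as Sum
open import Data.Vec using (Vec; []; _∷_; lookup)
open import Data.Vec.Membership.Propositional using (_∈_)
open import Data.Vec.Relation.Unary.Any using (here; there; index)
open import Data.Vec.Relation.Unary.Any.Properties using (lookup-index)
open import Function using (_∘_; id; case_of_)
open import Function.Bundles using (_⇔_; mk⇔; Equivalence)
open import Function.Definitions using (Injective)
open import Relation.Nullary using (¬_; Dec; yes; no; does)
open import Relation.Nullary.Decidable using (_×-dec_; _⊎-dec_; does-⇔; dec-true; dec-false)
open import Relation.Binary.PropositionalEquality hiding ([_])
open ≡-Reasoning

false≢true : false ≢ true
false≢true ()

count : ∀ {n} → (Fin n → Bool) → ℕ
count f = sum (tabulate (b2n ∘ f))

count-cong : ∀ {n} {f g : Fin n → Bool} → f ≗ g → count f ≡ count g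
count-cong {zero}  f≗g = refl
count-cong {suc n} f≗g = cong₂ _+_ (cong b2n (f≗g zero)) (count-cong (f≗g ∘ suc))

set : ∀ {n} → (Fin n → Bool) → Fin n → Bool → Fin n → Bool
set f p b v = if does (v ≟ p) then b else f v

set-other : ∀ {n} (f : Fin n → Bool) {p b v} → v ≢ p → set f p b v ≡ f v
set-other f {p} {b} {v} v≢p with v ≟ p
... | yes v≡p = ⊥-elim (v≢p v≡p)
... | no _    = refl

set-false : ∀ {n} (f : Fin n → Bool) {p v} → set f p false v ≡ true → v ≢ p × f v ≡ true
set-false f {p} {v} fv with v ≟ p
... | yes _   with () ← fv
... | no v≢p  = v≢p , fv

count-set : ∀ {n} (f : Fin n → Bool) p b → count (set f p b) + b2n (f p) ≡ count f + b2n b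
count-set {suc n} f zero b = begin
  b2n b + rest + b2n (f zero)    ≡⟨ ℕ.+-comm (b2n b + rest) _ ⟩
  b2n (f zero) + (b2n b + rest)  ≡⟨ cong (b2n (f zero) +_) (ℕ.+-comm (b2n b) rest) ⟩
  b2n (f zero) + (rest + b2n b)  ≡⟨ ℕ.+-assoc (b2n (f zero)) rest (b2n b) ⟨
  b2n (f zero) + rest + b2n b    ∎
  where rest = count (f ∘ suc)
count-set {suc n} f (suc p) b = begin
  b2n (f zero) + count (set (f ∘ suc) p b) + b2n (f (suc p))
    ≡⟨ ℕ.+-assoc (b2n (f zero)) _ _ ⟩
  b2n (f zero) + (count (set (f ∘ suc) p b) + b2n (f (suc p)))
    ≡⟨ cong (b2n (f zero) +_) (count-set (f ∘ suc) p b) ⟩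
  b2n (f zero) + (count (f ∘ suc) + b2n b)
    ≡⟨ ℕ.+-assoc (b2n (f zero)) _ _ ⟨
  b2n (f zero) + count (f ∘ suc) + b2n b
    ∎

count-witness : ∀ {n} (f : Fin n → Bool) {k} → count f ≡ suc k → ∃ λ v → f v ≡ true
count-witness {suc n} f c with f zero in f0
... | true  = zero , f0
... | false = let (v , fv) = count-witness (f ∘ suc) c in suc v , fv

count-zero : ∀ {n} (f : Fin n → Bool) {v} → count f ≡ 0 → f v ≢ true
count-zero {suc n} f {zero}  c fv with () ← trans (cong b2n (sym fv)) (ℕ.m+n≡0⇒m≡0 (b2n (f zero)) c)
count-zero {suc n} f {suc v} c fv = count-zero (f ∘ suc) (ℕ.m+n≡0⇒n≡0 (b2n (f zero)) c) fv

count-remove : ∀ {n} (f : Fin n → Bool) {p k} → f p ≡ true → count f ≡ suc k →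
               count (set f p false) ≡ k
count-remove f {p} {k} fp c = ℕ.suc-injective (begin
  suc (count (set f p false))        ≡⟨ ℕ.+-comm 1 _ ⟩
  count (set f p false) + b2n true   ≡⟨ cong (λ b → count (set f p false) + b2n b) fp ⟨
  count (set f p false) + b2n (f p)  ≡⟨ count-set f p false ⟩
  count f + 0                        ≡⟨ ℕ.+-identityʳ _ ⟩
  count f                            ≡⟨ c ⟩
  suc k                              ∎)

count-moved : ∀ {n} (f g : Fin n → Bool) {r t} → f r ≡ true → f t ≡ false → t ≢ r →
              g r ≡ false → g t ≡ true → (∀ v → v ≢ r → v ≢ t → g v ≡ f v) →
              count g ≡ count f
count-moved {n} f g {r} {t} fr ft t≢r gr gt gv = begin
  count g                  ≡⟨ count-cong pointwise ⟩
  count h′                 ≡⟨ ℕ.+-identityʳ _ ⟨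
  count h′ + 0             ≡⟨ cong (λ b → count h′ + b2n b) (trans (set-other f t≢r) ft) ⟨
  count h′ + b2n (h t)     ≡⟨ count-set h t true ⟩
  count h + b2n true       ≡⟨ cong (λ b → count h + b2n b) fr ⟨
  count h + b2n (f r)      ≡⟨ count-set f r false ⟩
  count f + 0              ≡⟨ ℕ.+-identityʳ _ ⟩
  count f                  ∎
  where
  h h′ : Fin n → Bool
  h  = set f r false
  h′ = set h t true
  pointwise : g ≗ h′
  pointwise v with v ≟ t
  ... | yes refl = gt
  ... | no v≢t with v ≟ r
  ...   | yes refl = gr
  ...   | no v≢r   = gv v v≢r v≢t

module CubicGraph {n} (G : Cubic n) where

  E-sym : ∀ {a b} → E G a b → E G b a
  E-sym {a} {b} e = trans (Cubic.sym G b a) e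

  E⇒≢ : ∀ {a b} → E G a b → a ≢ b
  E⇒≢ {a} e refl with () ← trans (sym e) (irrefl G a)

  ¬E⇒false : ∀ {a b} → ¬ E G a b → adj G a b ≡ false
  ¬E⇒false = Bool.¬-not

  triangle-flip : ∀ {a b c} → Triangle G a b c → Triangle G a c b
  triangle-flip (ab , bc , ca) = E-sym ca , E-sym bc , E-sym ab

  triangle-rotate : ∀ {a b c} → Triangle G a b c → Triangle G c a b
  triangle-rotate (ab , bc , ca) = ca , ab , bc

  degree : ∀ u → count (adj G u) ≡ 3
  degree u = trans (cong sum (sym (map-tabulate id (b2n ∘ adj G u)))) (deg3 G u)

  record ThirdNeighbour (u a b : Fin n) : Set where
    field
      t    : Fin n
      ut   : E G u t
      t≢a  : t ≢ a
      t≢b  : t ≢ b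
      only : ∀ {d} → E G u d → d ≡ a ⊎ d ≡ b ⊎ d ≡ t

  -- Delete a and b from the neighbourhood of u: one neighbour t remains, and
  -- after deleting t as well nothing remains.
  third : ∀ {u a b} → E G u a → E G u b → a ≢ b → ThirdNeighbour u a b
  third {u} {a} {b} ua ub a≢b = record { t = t ; ut = ut ; t≢a = t≢a ; t≢b = t≢b ; only = only }
    where
    N₁ N₂ N₃ : Fin n → Bool
    N₁ = set (adj G u) a false
    N₂ = set N₁ b false
    count₂ : count N₂ ≡ 1
    count₂ = count-remove N₁ (trans (set-other (adj G u) (≢-sym a≢b)) ub)
               (count-remove (adj G u) ua (degree u))
    witness : ∃ λ v → N₂ v ≡ true
    witness = count-witness N₂ count₂
    t : Fin n
    t = proj₁ witness
    in-N₁ : t ≢ b × N₁ t ≡ true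
    in-N₁ = set-false N₁ (proj₂ witness)
    in-G : t ≢ a × E G u t
    in-G = set-false (adj G u) (proj₂ in-N₁)
    t≢b : t ≢ b
    t≢b = proj₁ in-N₁
    t≢a : t ≢ a
    t≢a = proj₁ in-G
    ut : E G u t
    ut = proj₂ in-G
    N₃ = set N₂ t false
    only : ∀ {d} → E G u d → d ≡ a ⊎ d ≡ b ⊎ d ≡ t
    only {d} ud with d ≟ a | d ≟ b | d ≟ t
    ... | yes d≡a | _       | _       = inj₁ d≡a
    ... | no _    | yes d≡b | _       = inj₂ (inj₁ d≡b)
    ... | no _    | no _    | yes d≡t = inj₂ (inj₂ d≡t)
    ... | no d≢a  | no d≢b  | no d≢t  =
      ⊥-elim (count-zero N₃ {d} (count-remove N₂ (proj₂ witness) count₂)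
        (trans (set-other N₂ d≢t) (trans (set-other N₁ d≢b) (trans (set-other (adj G u) d≢a) ud))))

  non-neighbour : ∀ {u a b d} (T : ThirdNeighbour u a b) →
                  d ≢ a → d ≢ b → d ≢ ThirdNeighbour.t T → ¬ E G u d
  non-neighbour T d≢a d≢b d≢t ud = [ d≢a , [ d≢b , d≢t ]′ ]′ (ThirdNeighbour.only T ud)

  among : ∀ {u a b c d} → E G u a → E G u b → E G u c → a ≢ b → a ≢ c → b ≢ c →
          E G u d → d ≡ a ⊎ d ≡ b ⊎ d ≡ c
  among {c = c} ua ub uc a≢b a≢c b≢c ud =
    Sum.map₂ (Sum.map₂ (λ d≡t → trans d≡t (sym c≡t))) (only ud)
    where
    open ThirdNeighbour (third ua ub a≢b)
    c≡t : c ≡ t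
    c≡t = [ ⊥-elim ∘ ≢-sym a≢c , [ ⊥-elim ∘ ≢-sym b≢c , id ]′ ]′ (only uc)

  no-fourth : ∀ {u a b c d} → E G u a → E G u b → E G u c → E G u d →
              a ≢ b → a ≢ c → b ≢ c → d ≢ a → d ≢ b → d ≢ c → ⊥
  no-fourth ua ub uc ud a≢b a≢c b≢c d≢a d≢b d≢c =
    [ d≢a , [ d≢b , d≢c ]′ ]′ (among ua ub uc a≢b a≢c b≢c ud)

  record OtherNeighbours (u a : Fin n) : Set where
    field
      p q : Fin n
      up  : E G u p
      uq  : E G u q
      p≢a : p ≢ a
      q≢a : q ≢ a
      p≢q : p ≢ q

  -- Deleting a leaves two neighbours, so some p ≠ a remains; the third
  -- neighbour besides a and p is q.
  others : ∀ {u a} → E G u a → OtherNeighbours u a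
  others {u} {a} ua = record
    { p = p ; q = t ; up = up ; uq = ut ; p≢a = p≢a ; q≢a = t≢a ; p≢q = ≢-sym t≢b }
    where
    witness : ∃ λ v → set (adj G u) a false v ≡ true
    witness = count-witness (set (adj G u) a false) (count-remove (adj G u) ua (degree u))
    p : Fin n
    p = proj₁ witness
    in-G : p ≢ a × E G u p
    in-G = set-false (adj G u) (proj₂ witness)
    p≢a : p ≢ a
    p≢a = proj₁ in-G
    up : E G u p
    up = proj₂ in-G
    open ThirdNeighbour (third ua up (≢-sym p≢a))

  Link : Fin n → Fin n → Set
  Link d t = d ≡ t ⊎ E G d t

  link? : ∀ d t → Dec (Link d t)
  link? d t = d ≟ t ⊎-dec (adj G d t Bool.≟ true)

  link-edge : ∀ {d t} → Link d t → d ≢ t → E G d t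
  link-edge l d≢t = [ ⊥-elim ∘ d≢t , id ]′ l

-- A vertex set closed under adjacency with fewer than eight elements contains
-- the whole component of each of its members, contradicting ComponentAtLeast8.
module Components {n} (G : Cubic n) where
  open CubicGraph G

  Closed : ∀ {k} → Vec (Fin n) k → Set
  Closed vs = ∀ {u d} → u ∈ vs → E G u d → d ∈ vs

  reach-closed : ∀ {k} {vs : Vec (Fin n) k} {u v} → Closed vs → Reach G u v → u ∈ vs → v ∈ vs
  reach-closed closed here       u∈ = u∈
  reach-closed closed (step e r) u∈ = reach-closed closed r (closed u∈ e)

  -- The eight vertices reachable from w would inject into the closed set.
  small-closed : ∀ {k w} (vs : Vec (Fin n) k) → k < 8 → Closed vs → w ∈ vs →
                 ComponentAtLeast8 G w → ⊥
  small-closed {k} vs k<8 closed w∈ (f , f-injective , reach) =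
    ℕ.<⇒≱ k<8 (injective⇒≤ position-injective)
    where
    member : ∀ i → f i ∈ vs
    member i = reach-closed closed (reach i) w∈
    position : Fin 8 → Fin k
    position i = index (member i)
    position-injective : Injective _≡_ _≡_ position
    position-injective {i} {j} eq = f-injective (begin
      f i                    ≡⟨ lookup-index (member i) ⟩
      lookup vs (position i) ≡⟨ cong (lookup vs) eq ⟩
      lookup vs (position j) ≡⟨ lookup-index (member j) ⟨
      f j                    ∎)

  one-of : ∀ {k} {vs : Vec (Fin n) k} {d a b c} → d ≡ a ⊎ d ≡ b ⊎ d ≡ c →
           a ∈ vs → b ∈ vs → c ∈ vs → d ∈ vs
  one-of (inj₁ refl)        a∈ _  _  = a∈
  one-of (inj₂ (inj₁ refl)) _  b∈ _  = b∈
  one-of (inj₂ (inj₂ refl)) _  _  c∈ = c∈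

  -- A K4 is a component with four vertices.
  K4-small : ∀ {a b c v} → E G a b → E G a c → E G a v → E G b c → E G b v → E G c v →
             ComponentAtLeast8 G a → ⊥
  K4-small {a} {b} {c} {v} ab ac av bc bv cv =
    small-closed (a ∷ b ∷ c ∷ v ∷ []) (s≤s (s≤s (s≤s (s≤s (s≤s z≤n))))) closed (here refl)
    where
    vs : Vec (Fin n) 4
    vs = a ∷ b ∷ c ∷ v ∷ []
    a∈ : a ∈ vs
    a∈ = here refl
    b∈ : b ∈ vs
    b∈ = there (here refl)
    c∈ : c ∈ vs
    c∈ = there (there (here refl))
    v∈ : v ∈ vs
    v∈ = there (there (there (here refl)))
    closed : Closed vs
    closed (here refl) e = one-of (among ab ac av (E⇒≢ bc) (E⇒≢ bv) (E⇒≢ cv) e) b∈ c∈ v∈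
    closed (there (here refl)) e =
      one-of (among (E-sym ab) bc bv (E⇒≢ ac) (E⇒≢ av) (E⇒≢ cv) e) a∈ c∈ v∈
    closed (there (there (here refl))) e =
      one-of (among (E-sym ac) (E-sym bc) cv (E⇒≢ ab) (E⇒≢ av) (E⇒≢ bv) e) a∈ b∈ v∈
    closed (there (there (there (here refl)))) e =
      one-of (among (E-sym av) (E-sym bv) (E-sym cv) (E⇒≢ ab) (E⇒≢ ac) (E⇒≢ bc) e) a∈ b∈ c∈
    closed (there (there (there (there ())))) e

  -- A triangular prism (triangles a b c and a' b' c' joined by the matching
  -- aa', bb', cc') is a component with six vertices.
  prism-small : ∀ {a b c a' b' c'} → Triangle G a b c → Triangle G a' b' c' →
                E G a a' → E G b b' → E G c c' →
                a ≢ b' → a ≢ c' → b ≢ a' → b ≢ c' → c ≢ a' → c ≢ b' →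
                ComponentAtLeast8 G a → ⊥
  prism-small {a} {b} {c} {a'} {b'} {c'} (ab , bc , ca) (ab' , bc' , ca') aa' bb' cc'
              a≢b' a≢c' b≢a' b≢c' c≢a' c≢b' =
    small-closed vs (s≤s (s≤s (s≤s (s≤s (s≤s (s≤s (s≤s z≤n))))))) closed (here refl)
    where
    vs : Vec (Fin n) 6
    vs = a ∷ b ∷ c ∷ a' ∷ b' ∷ c' ∷ []
    a∈ : a ∈ vs
    a∈ = here refl
    b∈ : b ∈ vs
    b∈ = there (here refl)
    c∈ : c ∈ vs
    c∈ = there (there (here refl))
    a'∈ : a' ∈ vs
    a'∈ = there (there (there (here refl)))
    b'∈ : b' ∈ vs
    b'∈ = there (there (there (there (here refl))))
    c'∈ : c' ∈ vs
    c'∈ = there (there (there (there (there (here refl)))))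
    closed : Closed vs
    closed (here refl) e =
      one-of (among ab (E-sym ca) aa' (E⇒≢ bc) b≢a' c≢a' e) b∈ c∈ a'∈
    closed (there (here refl)) e =
      one-of (among (E-sym ab) bc bb' (E⇒≢ (E-sym ca)) a≢b' c≢b' e) a∈ c∈ b'∈
    closed (there (there (here refl))) e =
      one-of (among ca (E-sym bc) cc' (E⇒≢ ab) a≢c' b≢c' e) a∈ b∈ c'∈
    closed (there (there (there (here refl)))) e =
      one-of (among (E-sym aa') ab' (E-sym ca') a≢b' a≢c' (E⇒≢ bc') e) a∈ b'∈ c'∈
    closed (there (there (there (there (here refl))))) e =
      one-of (among (E-sym bb') (E-sym ab') bc' b≢a' b≢c' (E⇒≢ (E-sym ca')) e) b∈ a'∈ c'∈
    closed (there (there (there (there (there (here refl)))))) e =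
      one-of (among (E-sym cc') ca' (E-sym bc') c≢a' c≢b' (E⇒≢ ab') e) c∈ a'∈ b'∈
    closed (there (there (there (there (there (there ())))))) e

samePair? : ∀ {n} (u v x y : Fin n) → Dec (SamePair u v x y)
samePair? u v x y = (u ≟ x ×-dec v ≟ y) ⊎-dec (u ≟ y ×-dec v ≟ x)

samePair-swap : ∀ {n} {u v x y : Fin n} → SamePair u v x y → SamePair v u x y
samePair-swap (inj₁ (u≡x , v≡y)) = inj₂ (v≡y , u≡x)
samePair-swap (inj₂ (u≡y , v≡x)) = inj₁ (v≡x , u≡y)

samePair-diag : ∀ {n} {u x y : Fin n} → SamePair u u x y → x ≡ y
samePair-diag (inj₁ (refl , refl)) = refl
samePair-diag (inj₂ (refl , refl)) = refl

samePair-outside : ∀ {n} {u v x y : Fin n} → u ≢ x → u ≢ y → ¬ SamePair u v x y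
samePair-outside u≢x u≢y = [ u≢x ∘ proj₁ , u≢y ∘ proj₁ ]′

samePair-partner : ∀ {n} {v x y : Fin n} → x ≢ y → SamePair x v x y → v ≡ y
samePair-partner x≢y (inj₁ (_ , v≡y)) = v≡y
samePair-partner x≢y (inj₂ (x≡y , _)) = ⊥-elim (x≢y x≡y)

samePair-unique : ∀ {n} {u v x y x' y' : Fin n} →
                  SamePair u v x y → SamePair u v x' y' → SamePair x y x' y'
samePair-unique (inj₁ (refl , refl)) (inj₁ (refl , refl)) = inj₁ (refl , refl)
samePair-unique (inj₁ (refl , refl)) (inj₂ (refl , refl)) = inj₂ (refl , refl)
samePair-unique (inj₂ (refl , refl)) (inj₁ (refl , refl)) = inj₂ (refl , refl)
samePair-unique (inj₂ (refl , refl)) (inj₂ (refl , refl)) = inj₁ (refl , refl)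

-- The 2-switch on a, b, c, d deletes the pairs ab, cd and inserts ac, bd.
Removed Added : ∀ {n} (a b c d u v : Fin n) → Set
Removed a b c d u v = SamePair u v a b ⊎ SamePair u v c d
Added   a b c d u v = SamePair u v a c ⊎ SamePair u v b d

removed? : ∀ {n} (a b c d u v : Fin n) → Dec (Removed a b c d u v)
removed? a b c d u v = samePair? u v a b ⊎-dec samePair? u v c d

added? : ∀ {n} (a b c d u v : Fin n) → Dec (Added a b c d u v)
added? a b c d u v = samePair? u v a c ⊎-dec samePair? u v b d

update : (deleted inserted old : Bool) → Bool
update deleted inserted old = if deleted then false else if inserted then true else old

switchAdj : ∀ {n} → Cubic n → (a b c d : Fin n) → Fin n → Fin n → Bool
switchAdj G a b c d u v =
  update (does (removed? a b c d u v)) (does (added? a b c d u v)) (adj G u v)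

-- The switch depends only on which pairs are deleted and which inserted, so
-- the relabellings (a b)(c d) and (a c)(b d) describe the same switch.
switchAdj-relabel : ∀ {n} (G : Cubic n) {a b c d a' b' c' d' u v : Fin n} →
  Removed a b c d u v ⇔ Removed a' b' c' d' u v → Added a b c d u v ⇔ Added a' b' c' d' u v →
  switchAdj G a b c d u v ≡ switchAdj G a' b' c' d' u v
switchAdj-relabel G {a} {b} {c} {d} {a'} {b'} {c'} {d'} {u} {v} rem add =
  cong₂ (λ r s → update r s (adj G u v))
    (does-⇔ rem (removed? a b c d u v) (removed? a' b' c' d' u v))
    (does-⇔ add (added? a b c d u v) (added? a' b' c' d' u v))

switchAdj-swap₁ : ∀ {n} (G : Cubic n) {a b c d u v : Fin n} →
                  switchAdj G a b c d u v ≡ switchAdj G b a d c u v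
switchAdj-swap₁ G {a} {b} {c} {d} {u} {v} = switchAdj-relabel G {a} {b} {c} {d} {b} {a} {d} {c} {u} {v}
  (mk⇔ (Sum.map Sum.swap Sum.swap) (Sum.map Sum.swap Sum.swap)) (mk⇔ Sum.swap Sum.swap)

switchAdj-swap₂ : ∀ {n} (G : Cubic n) {a b c d u v : Fin n} →
                  switchAdj G a b c d u v ≡ switchAdj G c d a b u v
switchAdj-swap₂ G {a} {b} {c} {d} {u} {v} = switchAdj-relabel G {a} {b} {c} {d} {c} {d} {a} {b} {u} {v}
  (mk⇔ Sum.swap Sum.swap) (mk⇔ (Sum.map Sum.swap Sum.swap) (Sum.map Sum.swap Sum.swap))

module SwitchAdj {n} (G : Cubic n) (a b c d : Fin n) where
  open CubicGraph G

  switch-removed : ∀ {u v} → Removed a b c d u v → switchAdj G a b c d u v ≡ false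
  switch-removed {u} {v} r =
    cong (λ z → update z (does (added? a b c d u v)) (adj G u v)) (dec-true (removed? a b c d u v) r)

  switch-added : ∀ {u v} → ¬ Removed a b c d u v → Added a b c d u v → switchAdj G a b c d u v ≡ true
  switch-added {u} {v} ¬r s =
    cong₂ (λ z z' → update z z' (adj G u v)) (dec-false (removed? a b c d u v) ¬r) (dec-true (added? a b c d u v) s)

  switch-unchanged : ∀ {u v} → ¬ Removed a b c d u v → ¬ Added a b c d u v →
                     switchAdj G a b c d u v ≡ adj G u v
  switch-unchanged {u} {v} ¬r ¬s =
    cong₂ (λ z z' → update z z' (adj G u v)) (dec-false (removed? a b c d u v) ¬r) (dec-false (added? a b c d u v) ¬s)

  switch-sym : ∀ u v → switchAdj G a b c d u v ≡ switchAdj G a b c d v u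
  switch-sym u v = begin
    update (does (removed? a b c d u v)) (does (added? a b c d u v)) (adj G u v)
      ≡⟨ cong₂ (λ r s → update r s (adj G u v))
           (does-⇔ swap-pairs (removed? a b c d u v) (removed? a b c d v u))
           (does-⇔ swap-pairs (added? a b c d u v) (added? a b c d v u)) ⟩
    update (does (removed? a b c d v u)) (does (added? a b c d v u)) (adj G u v)
      ≡⟨ cong (update (does (removed? a b c d v u)) (does (added? a b c d v u))) (Cubic.sym G u v) ⟩
    update (does (removed? a b c d v u)) (does (added? a b c d v u)) (adj G v u)
      ∎
    where
    swap-pairs : ∀ {x y x' y'} → (SamePair u v x y ⊎ SamePair u v x' y') ⇔ (SamePair v u x y ⊎ SamePair v u x' y')
    swap-pairs = mk⇔ (Sum.map samePair-swap samePair-swap) (Sum.map samePair-swap samePair-swap)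

  -- In the row of a the switch moves the edge ab to ac, so a keeps degree 3.
  row-degree : a ≢ b → a ≢ c → a ≢ d → b ≢ c → E G a b → ¬ E G a c →
               count (switchAdj G a b c d a) ≡ 3
  row-degree a≢b a≢c a≢d b≢c ab ¬ac = trans
    (count-moved (adj G a) (switchAdj G a b c d a) ab (¬E⇒false ¬ac) (≢-sym b≢c)
      (switch-removed (inj₁ (inj₁ (refl , refl))))
      (switch-added ¬removed-c (inj₁ (inj₁ (refl , refl))))
      (λ v v≢b v≢c → switch-unchanged (¬removed v≢b) (¬added v≢c)))
    (degree a)
    where
    ¬removed : ∀ {v} → v ≢ b → ¬ Removed a b c d a v
    ¬removed v≢b = [ v≢b ∘ samePair-partner a≢b , samePair-outside a≢c a≢d ]′
    ¬removed-c : ¬ Removed a b c d a c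
    ¬removed-c = ¬removed (≢-sym b≢c)
    ¬added : ∀ {v} → v ≢ c → ¬ Added a b c d a v
    ¬added v≢c = [ v≢c ∘ samePair-partner a≢c , samePair-outside a≢b a≢d ]′

-- For distinct a, b, c, d with ab, cd edges and ac, bd non-edges, the
-- 2-switch is again a cubic graph, and it is the result of make(b a v c d)
-- for any common neighbour v of a and c.
module Switch {n} (G : Cubic n) {a b c d : Fin n}
  (a≢b : a ≢ b) (a≢c : a ≢ c) (a≢d : a ≢ d) (b≢c : b ≢ c) (b≢d : b ≢ d) (c≢d : c ≢ d)
  (ab : E G a b) (cd : E G c d) (¬ac : ¬ E G a c) (¬bd : ¬ E G b d) where
  open CubicGraph G
  open SwitchAdj G a b c d

  added⇒¬removed : ∀ {u v} → Added a b c d u v → ¬ Removed a b c d u v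
  added⇒¬removed (inj₁ ac) (inj₁ ab') = [ b≢c ∘ sym ∘ proj₂ , a≢b ∘ proj₁ ]′ (samePair-unique ac ab')
  added⇒¬removed (inj₁ ac) (inj₂ cd') = [ a≢c ∘ proj₁ , a≢d ∘ proj₁ ]′ (samePair-unique ac cd')
  added⇒¬removed (inj₂ bd) (inj₁ ab') = [ a≢b ∘ sym ∘ proj₁ , a≢d ∘ sym ∘ proj₂ ]′ (samePair-unique bd ab')
  added⇒¬removed (inj₂ bd) (inj₂ cd') = [ b≢c ∘ proj₁ , b≢d ∘ proj₁ ]′ (samePair-unique bd cd')

  switch-irrefl : ∀ u → switchAdj G a b c d u u ≡ false
  switch-irrefl u = case removed? a b c d u u of λ where
    (yes r) → switch-removed r
    (no ¬r) → trans (switch-unchanged ¬r [ a≢c ∘ samePair-diag , b≢d ∘ samePair-diag ]′) (irrefl G u)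

  unchanged : ∀ {u v} → u ≢ a → u ≢ b → u ≢ c → u ≢ d → switchAdj G a b c d u v ≡ adj G u v
  unchanged u≢a u≢b u≢c u≢d =
    switch-unchanged [ samePair-outside u≢a u≢b , samePair-outside u≢c u≢d ]′
                     [ samePair-outside u≢a u≢c , samePair-outside u≢b u≢d ]′

  -- Rows of b, c, d are rows of a for the relabelled switches.
  switch-degree : ∀ u → count (switchAdj G a b c d u) ≡ 3
  switch-degree u = by-position u (u ≟ a) (u ≟ b) (u ≟ c) (u ≟ d)
    where
    by-position : ∀ x → Dec (x ≡ a) → Dec (x ≡ b) → Dec (x ≡ c) → Dec (x ≡ d) →
                  count (switchAdj G a b c d x) ≡ 3
    by-position x (yes refl) _ _ _ = row-degree a≢b a≢c a≢d b≢c ab ¬ac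
    by-position x (no _) (yes refl) _ _ =
      trans (count-cong (λ v → switchAdj-swap₁ G {a} {b} {c} {d} {b} {v}))
        (SwitchAdj.row-degree G b a d c (≢-sym a≢b) b≢d b≢c a≢d (E-sym ab) ¬bd)
    by-position x (no _) (no _) (yes refl) _ =
      trans (count-cong (λ v → switchAdj-swap₂ G {a} {b} {c} {d} {c} {v}))
        (SwitchAdj.row-degree G c d a b c≢d (≢-sym a≢c) (≢-sym b≢c) (≢-sym a≢d) cd (¬ac ∘ E-sym))
    by-position x (no _) (no _) (no _) (yes refl) =
      trans (count-cong (λ v → trans (switchAdj-swap₂ G {a} {b} {c} {d} {d} {v}) (switchAdj-swap₁ G {c} {d} {a} {b} {d} {v})))
        (SwitchAdj.row-degree G d c b a (≢-sym c≢d) (≢-sym b≢d) (≢-sym a≢d) (≢-sym b≢c)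
          (E-sym cd) (¬bd ∘ E-sym))
    by-position x (no x≢a) (no x≢b) (no x≢c) (no x≢d) =
      trans (count-cong (λ v → unchanged {v = v} x≢a x≢b x≢c x≢d)) (degree x)

  G' : Cubic n
  G' = record
    { adj    = switchAdj G a b c d
    ; sym    = switch-sym
    ; irrefl = switch-irrefl
    ; deg3   = λ u → trans (cong sum (map-tabulate id (b2n ∘ switchAdj G a b c d u))) (switch-degree u)
    }

  inserted : ∀ {u v} → Added a b c d u v → E G' u v
  inserted s = switch-added (added⇒¬removed s) s

  deleted : ∀ {u v} → Removed a b c d u v → adj G' u v ≡ false
  deleted = switch-removed

  replaces : Replaces G G' a b c d a c b d
  replaces u v = mk⇔ to from
    where
    Kept : Set
    Kept = E G u v × ¬ SamePair u v a b × ¬ SamePair u v c d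
    to : E G' u v → Kept ⊎ Added a b c d u v
    to e = case added? a b c d u v of λ where
      (yes s) → inj₂ s
      (no ¬s) → case removed? a b c d u v of λ where
        (yes r) → ⊥-elim (false≢true (trans (sym (switch-removed r)) e))
        (no ¬r) → inj₁ (trans (sym (switch-unchanged ¬r ¬s)) e , ¬r ∘ inj₁ , ¬r ∘ inj₂)
    from : Kept ⊎ Added a b c d u v → E G' u v
    from (inj₂ s) = inserted s
    from (inj₁ (e , ¬ab , ¬cd)) = case added? a b c d u v of λ where
      (yes s) → inserted s
      (no ¬s) → trans (switch-unchanged [ ¬ab , ¬cd ]′ ¬s) e

  kept : ∀ {u v} → E G u v → ¬ SamePair u v a b → ¬ SamePair u v c d → E G' u v
  kept e ¬ab ¬cd = Equivalence.from (replaces _ _) (inj₁ (e , ¬ab , ¬cd))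

  unchanged' : ∀ {u v} → v ≢ a → v ≢ b → v ≢ c → v ≢ d → adj G' u v ≡ adj G u v
  unchanged' {u} {v} v≢a v≢b v≢c v≢d =
    trans (switch-sym u v) (trans (unchanged v≢a v≢b v≢c v≢d) (Cubic.sym G v u))

  make : ∀ {v} → E G a v → E G v c → b ≢ v → v ≢ d → Make G G'
  make {v} av vc b≢v v≢d = b , a , v , c , d ,
    (≢-sym a≢b , b≢v , b≢c , b≢d , E⇒≢ av , a≢c , a≢d , E⇒≢ vc , v≢d , c≢d) ,
    E-sym ab , av , vc , cd , ¬ac , ¬bd , replaces

dist-zero : ∀ {n} (G : Cubic n) → DistLe2 G G
dist-zero G = inj₁ (λ _ _ → refl)

one-make : ∀ {n} {G G' : Cubic n} → Make G G' → DistLe2 G G'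
one-make m = inj₂ (inj₁ (inj₁ (inj₁ m)))

two-makes : ∀ {n} {G G₁ G' : Cubic n} → Make G G₁ → Make G₁ G' → DistLe2 G G'
two-makes {G₁ = G₁} m₁ m₂ = inj₂ (inj₂ (G₁ , inj₁ (inj₁ m₁) , inj₁ (inj₁ m₂)))

-- A vertex adjacent to exactly two vertices of a triangle spans an induced
-- diamond with it: the adjacency bits sum to 2 + 3.
induced-diamond : ∀ {n} (H : Cubic n) {v w x y} → Triangle H w x y → v ≢ w → v ≢ x → v ≢ y →
  ∀ {b₁ b₂ b₃} → adj H v w ≡ b₁ → adj H v x ≡ b₂ → adj H v y ≡ b₃ →
  b2n b₁ + b2n b₂ + b2n b₃ ≡ 2 → InducedDiamond H v w x y
induced-diamond H {v} {w} {x} {y} (wx , xy , yw) v≢w v≢x v≢y refl refl refl two =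
  (v≢w , v≢x , v≢y , E⇒≢ wx , ≢-sym (E⇒≢ yw) , E⇒≢ xy) , five
  where
  open CubicGraph H
  five : b2n (adj H v w) + b2n (adj H v x) + b2n (adj H v y) +
         b2n (adj H w x) + b2n (adj H w y) + b2n (adj H x y) ≡ 5
  five rewrite wx | E-sym yw | xy | two = refl

record Attached {n} (G : Cubic n) (s t r s' : Fin n) : Set where
  field
    graph    : Cubic n
    move     : Make G graph
    triangle : Triangle graph s t r
    s's      : E graph s' s
    s't      : E graph s' t
    s'r      : adj graph s' r ≡ adj G s' r

-- Let s t r be a triangle, s' and t' further neighbours of s and t, and d a
-- neighbour of s' not adjacent to t'.  Then make(d s' s t t') joins s' to t,
-- keeping the triangle and all pairs at r.
attach : ∀ {n} (G : Cubic n) {s t r s' t' d} → Triangle G s t r →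
  E G s s' → E G t t' → E G s' d → ¬ E G s' t → ¬ E G d t' →
  s' ≢ t → s' ≢ r → t' ≢ s → t' ≢ r → s' ≢ t' → d ≢ s → d ≢ t' → d ≢ r →
  Attached G s t r s'
attach G {s} {t} {r} {s'} {t'} {d} (st , tr , rs) ss' tt' s'd ¬s't ¬dt'
       s'≢t s'≢r t'≢s t'≢r s'≢t' d≢s d≢t' d≢r = record
  { graph    = S.G'
  ; move     = S.make (E-sym ss') st d≢s (≢-sym t'≢s)
  ; triangle = trans s-kept st , trans r-kept' tr , trans r-kept rs
  ; s's      = trans s-kept' (E-sym ss')
  ; s't      = S.inserted (inj₁ (inj₁ (refl , refl)))
  ; s'r      = r-kept'
  }
  where
  open CubicGraph G
  d≢t : d ≢ t
  d≢t refl = ¬s't s'd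
  module S = Switch G (E⇒≢ s'd) s'≢t s'≢t' d≢t d≢t' (E⇒≢ tt') s'd tt' ¬s't ¬dt'
  s-kept : ∀ {v} → adj S.G' s v ≡ adj G s v
  s-kept = S.unchanged (E⇒≢ ss') (≢-sym d≢s) (E⇒≢ st) (≢-sym t'≢s)
  s-kept' : ∀ {u} → adj S.G' u s ≡ adj G u s
  s-kept' = S.unchanged' (E⇒≢ ss') (≢-sym d≢s) (E⇒≢ st) (≢-sym t'≢s)
  r-kept : ∀ {v} → adj S.G' r v ≡ adj G r v
  r-kept = S.unchanged (≢-sym s'≢r) (≢-sym d≢r) (≢-sym (E⇒≢ tr)) (≢-sym t'≢r)
  r-kept' : ∀ {u} → adj S.G' u r ≡ adj G u r
  r-kept' = S.unchanged' (≢-sym s'≢r) (≢-sym d≢r) (≢-sym (E⇒≢ tr)) (≢-sym t'≢r)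

module Main {n} (G : Cubic n) {w x y : Fin n}
  (wx : E G w x) (xy : E G x y) (yw : E G y w) (big : ComponentAtLeast8 G w) where
  open CubicGraph G
  open Components G

  Goal : Set
  Goal = Σ (Fin n) λ v → Σ (Cubic n) λ G' → DistLe2 G G' × InducedDiamond G' v w x y

  triangle : Triangle G w x y
  triangle = wx , xy , yw

  w≢x : w ≢ x
  w≢x = E⇒≢ wx
  x≢y : x ≢ y
  x≢y = E⇒≢ xy
  w≢y : w ≢ y
  w≢y = ≢-sym (E⇒≢ yw)

  Tw : ThirdNeighbour w x y
  Tw = third wx (E-sym yw) x≢y
  Tx : ThirdNeighbour x w y
  Tx = third (E-sym wx) xy w≢y
  Ty : ThirdNeighbour y w x
  Ty = third yw (E-sym xy) w≢x

  open ThirdNeighbour Tw using () renaming (t to w'; ut to ww'; t≢a to w'≢x; t≢b to w'≢y)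
  open ThirdNeighbour Tx using () renaming (t to x'; ut to xx'; t≢a to x'≢w; t≢b to x'≢y)
  open ThirdNeighbour Ty using () renaming (t to y'; ut to yy'; t≢a to y'≢w; t≢b to y'≢x)

  w'≢w : w' ≢ w
  w'≢w = ≢-sym (E⇒≢ ww')
  x'≢x : x' ≢ x
  x'≢x = ≢-sym (E⇒≢ xx')
  y'≢y : y' ≢ y
  y'≢y = ≢-sym (E⇒≢ yy')

  off-w : ∀ {v} → v ≢ x → v ≢ y → v ≢ w' → ¬ E G v w
  off-w v≢x v≢y v≢w' = non-neighbour Tw v≢x v≢y v≢w' ∘ E-sym
  off-x : ∀ {v} → v ≢ w → v ≢ y → v ≢ x' → ¬ E G v x
  off-x v≢w v≢y v≢x' = non-neighbour Tx v≢w v≢y v≢x' ∘ E-sym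
  off-y : ∀ {v} → v ≢ w → v ≢ x → v ≢ y' → ¬ E G v y
  off-y v≢w v≢x v≢y' = non-neighbour Ty v≢w v≢x v≢y' ∘ E-sym

  shared-wx : w' ≡ x' → w' ≢ y' → Goal
  shared-wx w'≡x' w'≢y' = w' , G , dist-zero G ,
    induced-diamond G triangle w'≢w w'≢x w'≢y
      (E-sym ww') (E-sym (subst (E G x) (sym w'≡x') xx')) (¬E⇒false (off-y w'≢w w'≢x w'≢y')) refl

  shared-wy : w' ≡ y' → w' ≢ x' → Goal
  shared-wy w'≡y' w'≢x' = w' , G , dist-zero G ,
    induced-diamond G triangle w'≢w w'≢x w'≢y
      (E-sym ww') (¬E⇒false (off-x w'≢w w'≢y w'≢x')) (E-sym (subst (E G y) (sym w'≡y') yy')) refl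

  shared-xy : x' ≡ y' → w' ≢ x' → Goal
  shared-xy x'≡y' w'≢x' = x' , G , dist-zero G ,
    induced-diamond G triangle x'≢w x'≢x x'≢y
      (¬E⇒false (off-w x'≢x x'≢y (≢-sym w'≢x'))) (E-sym xx') (E-sym (subst (E G y) (sym x'≡y') yy')) refl

  shared-all : w' ≡ x' → w' ≡ y' → ⊥
  shared-all w'≡x' w'≡y' =
    K4-small wx (E-sym yw) ww' xy (subst (E G x) (sym w'≡x') xx') (subst (E G y) (sym w'≡y') yy') big

  module Generic (w'≢x' : w' ≢ x') (w'≢y' : w' ≢ y') (x'≢y' : x' ≢ y') where
    open OtherNeighbours (others (E-sym ww'))
      renaming (up to w'p; uq to w'q; p≢a to p≢w; q≢a to q≢w)

    w'≁x : ¬ E G w' x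
    w'≁x = off-x w'≢w w'≢y w'≢x'
    w'≁y : ¬ E G w' y
    w'≁y = off-y w'≢w w'≢x w'≢y'
    x'≁w : ¬ E G x' w
    x'≁w = off-w x'≢x x'≢y (≢-sym w'≢x')
    x'≁y : ¬ E G x' y
    x'≁y = off-y x'≢w x'≢x x'≢y'

    off-triangle : ∀ {d} → E G w' d → d ≢ x × d ≢ y
    off-triangle w'd = (λ { refl → w'≁x w'd }) , (λ { refl → w'≁y w'd })

    via-x : ∀ {d} → E G w' d → d ≢ w → ¬ Link d x' → Goal
    via-x w'd d≢w ¬link = w' , graph , one-make {G = G} {G' = graph} move ,
      induced-diamond graph moved-triangle w'≢w w'≢x w'≢y s's s't (trans s'r (¬E⇒false w'≁y)) refl
      where
      open Attached (attach G triangle ww' xx' w'd w'≁x (¬link ∘ inj₂)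
        w'≢x w'≢y x'≢w x'≢y w'≢x' d≢w (¬link ∘ inj₁) (proj₂ (off-triangle w'd)))
        using (graph; move; s's; s't; s'r) renaming (triangle to moved-triangle)

    via-y : ∀ {d} → E G w' d → d ≢ w → ¬ Link d y' → Goal
    via-y w'd d≢w ¬link = w' , graph , one-make {G = G} {G' = graph} move ,
      induced-diamond graph (CubicGraph.triangle-flip graph {w} {y} {x} moved-triangle) w'≢w w'≢x w'≢y
        s's (trans s'r (¬E⇒false w'≁x)) s't refl
      where
      open Attached (attach G (triangle-flip triangle) ww' yy' w'd w'≁y (¬link ∘ inj₂)
        w'≢y w'≢x y'≢w y'≢x w'≢y' d≢w (¬link ∘ inj₁) (proj₁ (off-triangle w'd)))
        using (graph; move; s's; s't; s'r) renaming (triangle to moved-triangle)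

    -- The pendants cannot span a triangle: with w x y they would form a prism.
    no-pendant-triangle : E G w' x' → E G x' y' → E G y' w' → ⊥
    no-pendant-triangle w'x' x'y' y'w' =
      prism-small triangle (w'x' , x'y' , y'w') ww' xx' yy'
        (≢-sym x'≢w) (≢-sym y'≢w) (≢-sym w'≢x) (≢-sym y'≢x) (≢-sym w'≢y) (≢-sym x'≢y) big

    -- A neighbour of w' cannot be x' when the other neighbour e is linked to x'
    -- and y' and x' is linked to y': either w' x' y' is a triangle or x' has
    -- the four neighbours x, w', e, y'.
    x'-neighbour : ∀ {d e} → E G w' d → E G w' e → d ≢ e → d ≡ x' →
                   Link e x' → Link d y' → Link e y' → ⊥
    x'-neighbour {e = e} w'x' w'e x'≢e refl ex' x'y' ey' = [ pendant-triangle , fourth ]′ ey'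
      where
      x'y'-edge : E G x' y'
      x'y'-edge = link-edge x'y' x'≢y'
      pendant-triangle : e ≡ y' → ⊥
      pendant-triangle refl = no-pendant-triangle w'x' x'y'-edge (E-sym w'e)
      fourth : E G e y' → ⊥
      fourth ey'-edge = no-fourth (E-sym xx') (E-sym w'x') (E-sym (link-edge ex' (≢-sym x'≢e))) x'y'-edge
        (≢-sym w'≢x) (≢-sym (proj₁ (off-triangle w'e))) (E⇒≢ w'e)
        y'≢x (≢-sym w'≢y') (≢-sym (E⇒≢ ey'-edge))

    y'-neighbour : ∀ {d e} → E G w' d → E G w' e → d ≢ e → d ≡ y' →
                   Link e y' → Link d x' → Link e x' → ⊥
    y'-neighbour {e = e} w'y' w'e y'≢e refl ey' y'x' ex' = [ pendant-triangle , fourth ]′ ex'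
      where
      y'x'-edge : E G y' x'
      y'x'-edge = link-edge y'x' (≢-sym x'≢y')
      pendant-triangle : e ≡ x' → ⊥
      pendant-triangle refl = no-pendant-triangle w'e (E-sym y'x'-edge) (E-sym w'y')
      fourth : E G e x' → ⊥
      fourth ex'-edge = no-fourth (E-sym yy') (E-sym w'y') (E-sym (link-edge ey' (≢-sym y'≢e))) y'x'-edge
        (≢-sym w'≢y) (≢-sym (proj₂ (off-triangle w'e))) (E⇒≢ w'e)
        x'≢y (≢-sym w'≢x') (≢-sym (E⇒≢ ex'-edge))

    -- If p and q are both adjacent to x' and y', then make(x' p w' q y')
    -- replaces px', qy' by pq, x'y' and leaves x, y, w untouched; afterwards q
    -- is a neighbour of x' not adjacent to y'.
    module FirstMove (px' : E G p x') (qx' : E G q x') (py' : E G p y') (qy' : E G q y') where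
      x≢p : x ≢ p
      x≢p = ≢-sym (proj₁ (off-triangle w'p))
      x≢q : x ≢ q
      x≢q = ≢-sym (proj₁ (off-triangle w'q))
      y≢p : y ≢ p
      y≢p = ≢-sym (proj₂ (off-triangle w'p))
      y≢q : y ≢ q
      y≢q = ≢-sym (proj₂ (off-triangle w'q))
      x'≢q : x' ≢ q
      x'≢q = ≢-sym (E⇒≢ qx')
      -- p has neighbours w', x', y', so p ≁ q; x' has x, p, q, so x' ≁ y'.
      ¬pq : ¬ E G p q
      ¬pq pq = no-fourth (E-sym w'p) px' py' pq w'≢x' w'≢y' x'≢y'
                 (≢-sym (E⇒≢ w'q)) (≢-sym x'≢q) (E⇒≢ qy')
      ¬x'y' : ¬ E G x' y'
      ¬x'y' x'y' = no-fourth (E-sym xx') (E-sym px') (E-sym qx') x'y' x≢p x≢q p≢q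
                     y'≢x (≢-sym (E⇒≢ py')) (≢-sym (E⇒≢ qy'))
      module S = Switch G (E⇒≢ px') p≢q (E⇒≢ py') x'≢q x'≢y' (E⇒≢ qy') px' qy' ¬pq ¬x'y'
      -- x and w lie outside the switched vertices {p, x', q, y'}.
      x-kept : ∀ {v} → adj S.G' x v ≡ adj G x v
      x-kept {v} = S.unchanged {x} {v} x≢p (≢-sym x'≢x) x≢q (≢-sym y'≢x)
      w-kept : ∀ {u} → adj S.G' u w ≡ adj G u w
      w-kept {u} = S.unchanged' {u} {w} (≢-sym p≢w) (≢-sym x'≢w) (≢-sym q≢w) (≢-sym y'≢w)
      y-kept : ∀ {u} → adj S.G' u y ≡ adj G u y
      y-kept {u} = S.unchanged' {u} {y} y≢p (≢-sym x'≢y) y≢q (≢-sym y'≢y)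
      move₁ : Make G S.G'
      move₁ = S.make (E-sym w'p) w'q (≢-sym w'≢x') w'≢y'
      xy₁ : E S.G' x y
      xy₁ = trans (x-kept {y}) xy
      yw₁ : E S.G' y w
      yw₁ = trans (w-kept {y}) yw
      wx₁ : E S.G' w x
      wx₁ = trans (S.unchanged' {w} {x} x≢p (≢-sym x'≢x) x≢q (≢-sym y'≢x)) wx
      xx'₁ : E S.G' x x'
      xx'₁ = trans (x-kept {x'}) xx'
      yy'₁ : E S.G' y y'
      yy'₁ = trans (S.unchanged {y} {y'} y≢p (≢-sym x'≢y) y≢q (≢-sym y'≢y)) yy'
      -- x'q is neither of the deleted pairs px', qy'.
      x'q₁ : E S.G' x' q
      x'q₁ = S.kept {x'} {q} (E-sym qx') [ ≢-sym (E⇒≢ px') ∘ proj₁ , p≢q ∘ sym ∘ proj₂ ]′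
               (samePair-outside x'≢q x'≢y')
      ¬x'y₁ : ¬ E S.G' x' y
      ¬x'y₁ = x'≁y ∘ trans (sym (y-kept {x'}))
      ¬qy'₁ : ¬ E S.G' q y'
      ¬qy'₁ = false≢true ∘ trans (sym (S.deleted {q} {y'} (inj₂ (inj₁ (refl , refl)))))
      x'w₁ : adj S.G' x' w ≡ false
      x'w₁ = trans (w-kept {x'}) (¬E⇒false x'≁w)

    -- After the first move, attaching x' to the edge x y by make(q x' x y y')
    -- produces the diamond x' w x y.
    two-moves : E G p x' → E G q x' → E G p y' → E G q y' → Goal
    two-moves px' qx' py' qy' = x' , graph , two-makes {G = G} {G₁ = S.G'} {G' = graph} move₁ move ,
      induced-diamond graph (CubicGraph.triangle-rotate graph {x} {y} {w} moved-triangle) x'≢w x'≢x x'≢y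
        (trans s'r x'w₁) s's s't refl
      where
      open FirstMove px' qx' py' qy'
      open Attached (attach S.G' {x} {y} {w} {x'} {y'} {q} (xy₁ , yw₁ , wx₁) xx'₁ yy'₁ x'q₁ ¬x'y₁ ¬qy'₁
        x'≢y x'≢w y'≢x y'≢w x'≢y' (proj₁ (off-triangle w'q)) (E⇒≢ qy') q≢w)
        using (graph; move; s's; s't; s'r) renaming (triangle to moved-triangle)

    linked : Link p x' → Link q x' → Link p y' → Link q y' → Goal
    linked (inj₁ p≡x') qx' py' qy' = ⊥-elim (x'-neighbour w'p w'q p≢q p≡x' qx' py' qy')
    linked px' (inj₁ q≡x') py' qy' = ⊥-elim (x'-neighbour w'q w'p (≢-sym p≢q) q≡x' px' qy' py')
    linked px' qx' (inj₁ p≡y') qy' = ⊥-elim (y'-neighbour w'p w'q p≢q p≡y' qy' px' qx')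
    linked px' qx' py' (inj₁ q≡y') = ⊥-elim (y'-neighbour w'q w'p (≢-sym p≢q) q≡y' py' qx' px')
    linked (inj₂ px') (inj₂ qx') (inj₂ py') (inj₂ qy') = two-moves px' qx' py' qy'

    result : Goal
    result = decide (link? p x') (link? q x') (link? p y') (link? q y')
      where
      decide : Dec (Link p x') → Dec (Link q x') → Dec (Link p y') → Dec (Link q y') → Goal
      decide (no ¬l) _      _      _      = via-x w'p p≢w ¬l
      decide _      (no ¬l) _      _      = via-x w'q q≢w ¬l
      decide _      _      (no ¬l) _      = via-y w'p p≢w ¬l
      decide _      _      _      (no ¬l) = via-y w'q q≢w ¬l
      decide (yes px') (yes qx') (yes py') (yes qy') = linked px' qx' py' qy'

  result : Goal
  result = decide (w' ≟ x') (w' ≟ y') (x' ≟ y')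
    where
    decide : Dec (w' ≡ x') → Dec (w' ≡ y') → Dec (x' ≡ y') → Goal
    decide (yes w'≡x') (yes w'≡y') _          = ⊥-elim (shared-all w'≡x' w'≡y')
    decide (yes w'≡x') (no w'≢y')  _          = shared-wx w'≡x' w'≢y'
    decide (no w'≢x')  (yes w'≡y') _          = shared-wy w'≡y' w'≢x'
    decide (no w'≢x')  (no _)      (yes x'≡y') = shared-xy x'≡y' w'≢x'
    decide (no w'≢x')  (no w'≢y')  (no x'≢y')  = Generic.result w'≢x' w'≢y' x'≢y'

lemma6 : (n : ℕ) → 4 ≤ n → 2 ∣ n → (G : Cubic n) → (w x y : Fin n) →
    Triangle G w x y → ComponentAtLeast8 G w →
    Σ (Fin n) λ v → Σ (Cubic n) λ G' → DistLe2 G G' × InducedDiamond G' v w x y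
lemma6 n _ _ G w x y (wx , xy , yw) big = Main.result G wx xy yw big
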